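{- Let $n\ge 1$ and let $G$ be a self-complementary graph on $4n$ vertices. Let $L$ be the set of edges of $G$ joining a vertex of degree at least $2n$ to a vertex of degree at most $2n-1$. Then $G$ contains a $K_{2n}$ minor obtained by contracting $2n$ pairwise nonadjacent edges belonging to $L$.
   Context: Graphs are finite, simple and undirected. $cG$ denotes the complement of $G$ (same vertex set, two distinct vertices adjacent in $cG$ iff not adjacent in $G$); $G$ is self-complementary if $G\cong cG$. A minor is obtained by edge deletions, vertex deletions and edge contractions. -}

module Defs where

open import Data.Nat using (ℕ; _+_; _*_; _≤_; _<_)
open import Data.Fin using (Fin; _≟_)
open import Data.Bool using (Bool; true; false; not; _∧_; if_then_else_)
open import Data.List using (List; allFin; map)
open import Data.Nat.ListAction using (sum)
open import Data.Product using (Σ; _×_; ∃-syntax)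
open import Data.Sum using (_⊎_)
open import Relation.Nullary using (¬_)
open import Relation.Nullary.Decidable using (⌊_⌋)
open import Relation.Binary.PropositionalEquality using (_≡_; _≢_)
open import Function.Bundles using (_↔_; Inverse)

Adj : ℕ → Set
Adj m = Fin m → Fin m → Bool

IsSimpleGraph : {m : ℕ} → Adj m → Set
IsSimpleGraph {m} G = (∀ x y → G x y ≡ G y x) × (∀ x → G x x ≡ false)

complement : {m : ℕ} → Adj m → Adj m
complement G x y = not ⌊ x ≟ y ⌋ ∧ not (G x y)

Isomorphic : {m : ℕ} → Adj m → Adj m → Set
Isomorphic {m} G H =
  Σ (Fin m ↔ Fin m) λ f → ∀ x y → G x y ≡ H (Inverse.to f x) (Inverse.to f y)

SelfComplementary : {m : ℕ} → Adj m → Set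
SelfComplementary G = Isomorphic G (complement G)

degree : {m : ℕ} → Adj m → Fin m → ℕ
degree {m} G x = sum (map (λ y → if G x y then 1 else 0) (allFin m))

InL : {m : ℕ} → ℕ → Adj m → Fin m → Fin m → Set
InL n G u v = (G u v ≡ true) × (2 * n ≤ degree G u) × (degree G v < 2 * n)

-- A family of k edges a i — b i (i : Fin k) that are pairwise nonadjacent,
-- i.e. all 2k endpoints are distinct (a matching).
IsMatching : {m k : ℕ} → (Fin k → Fin m) → (Fin k → Fin m) → Set
IsMatching {m} {k} a b =
  (∀ i j → a i ≡ a j → i ≡ j) × (∀ i j → b i ≡ b j → i ≡ j) × (∀ i j → a i ≢ b j)

-- Adjacency of the graph obtained from G by contracting the edges a i — b i
-- of a perfect matching (vertex i of the contracted graph = contracted edge i):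
-- i ≠ j are adjacent iff some edge of G joins {a i, b i} to {a j, b j}.
ContractedAdj : {m k : ℕ} → Adj m → (Fin k → Fin m) → (Fin k → Fin m) → Fin k → Fin k → Set
ContractedAdj G a b i j =
  (i ≢ j) × ∃[ u ] ∃[ v ] ((u ≡ a i ⊎ u ≡ b i) × (v ≡ a j ⊎ v ≡ b j) × (G u v ≡ true))

IsComplete : {k : ℕ} → (Fin k → Fin k → Set) → Set
IsComplete {k} H = ∀ i j → i ≢ j → H i j

-- Let σ be an isomorphism from G onto its complement. Then deg x + deg σx = 4n − 1, so exactly
-- one of x and σx has degree ≥ 2n; in particular σ pairs the high vertices with the low ones and
-- there are exactly 2n high vertices. Call y—σy a σ-edge when it is an edge of G; since y ~ σy
-- iff σy ≁ σ²y, every high vertex h lies on exactly one σ-edge (y = h or σy = h), whose other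
-- endpoint is low, and no two σ-edges share an endpoint. These 2n σ-edges form the matching.
-- For distinct σ-edges y—σy and y'—σy', either y ~ y' or, σ being an isomorphism onto the
-- complement, σy ~ σy'; so the contracted graph is complete.
module Submission where

open import Defs
open import Data.Bool using (Bool; true; false; not; _∧_; T; if_then_else_)
open import Data.Empty using (⊥-elim)
open import Data.Fin using (Fin; zero; suc; _≟_; punchIn)
open import Data.Fin.Properties using (suc-injective; punchInᵢ≢i)
open import Data.List using (map; tabulate)
import Data.Nat.ListAction as List
open import Data.Nat using (ℕ; zero; suc; _+_; _*_; _≤_; _<_; _≥_; _≤?_)
open import Data.Nat.Properties
  using (+-0-commutativeMonoid; +-cancelˡ-≤; +-monoˡ-≤; +-suc; +-comm; +-identityʳ; *-cancelˡ-≡;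
         *-distribʳ-+; <⇒≱; ≰⇒>; module ≤-Reasoning)
open import Algebra.Properties.CommutativeMonoid.Sum +-0-commutativeMonoid
  using (sum; sum-cong-≗; sum-remove; sum-replicate-zero; ∑-distrib-+; sum-permute)
open import Data.Product using (_×_; ∃-syntax; _,_; proj₁; proj₂)
open import Data.Sum using (_⊎_; inj₁; inj₂)
open import Data.Unit using (tt)
open import Function using (_∘_)
open import Function.Bundles using (_↔_; Inverse; Injection)
open import Function.Properties.Inverse using (Inverse⇒Injection)
open import Data.Bool.Properties using (not-injective)
open import Relation.Nullary using (yes; no)
open import Relation.Nullary.Decidable using (⌊_⌋; toWitness)
open import Relation.Binary.PropositionalEquality

indicator : Bool → ℕ
indicator b = if b then 1 else 0

count : ∀ {m} → (Fin m → Bool) → ℕ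
count p = sum (indicator ∘ p)

sum-map-tabulate : ∀ {m} {A : Set} (f : A → ℕ) (g : Fin m → A) →
                   List.sum (map f (tabulate g)) ≡ sum (f ∘ g)
sum-map-tabulate {zero} f g = refl
sum-map-tabulate {suc m} f g = cong (f (g zero) +_) (sum-map-tabulate f (g ∘ suc))

degree≡count : ∀ {m} (G : Adj m) x → degree G x ≡ count (G x)
degree≡count G x = sum-map-tabulate (indicator ∘ G x) (λ y → y)

count-const-true : ∀ m → count {m} (λ _ → true) ≡ m
count-const-true zero = refl
count-const-true (suc m) = cong suc (count-const-true m)

count-permute : ∀ {m} (π : Fin m ↔ Fin m) (p : Fin m → Bool) → count (p ∘ Inverse.to π) ≡ count p
count-permute π p = sym (sum-permute (indicator ∘ p) π)

⌊≟⌋-refl : ∀ {m} (x : Fin m) → ⌊ x ≟ x ⌋ ≡ true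
⌊≟⌋-refl x with x ≟ x
... | yes _ = refl
... | no x≢x = ⊥-elim (x≢x refl)

⌊≟⌋-≢ : ∀ {m} {x y : Fin m} → x ≢ y → ⌊ x ≟ y ⌋ ≡ false
⌊≟⌋-≢ {x = x} {y} x≢y with x ≟ y
... | yes x≡y = ⊥-elim (x≢y x≡y)
... | no _ = refl

count-≟ : ∀ {m} (x : Fin m) → count (λ y → ⌊ x ≟ y ⌋) ≡ 1
count-≟ {suc m} x = begin
  count (λ y → ⌊ x ≟ y ⌋)
    ≡⟨ sum-remove {i = x} (indicator ∘ (λ y → ⌊ x ≟ y ⌋)) ⟩
  indicator ⌊ x ≟ x ⌋ + sum (indicator ∘ others)
    ≡⟨ cong₂ _+_ (cong indicator (⌊≟⌋-refl x)) (sum-cong-≗ (cong indicator ∘ others-false)) ⟩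
  1 + sum {m} (λ _ → 0)
    ≡⟨ cong suc (sum-replicate-zero m) ⟩
  1 ∎
  where
  open ≡-Reasoning
  others : Fin m → Bool
  others y = ⌊ x ≟ punchIn x y ⌋
  others-false : ∀ y → others y ≡ false
  others-false y = ⌊≟⌋-≢ (punchInᵢ≢i x y ∘ sym)

record Distinct {m} (k : ℕ) (P : Fin m → Set) : Set where
  field
    elem : Fin k → Fin m
    elem-injective : ∀ i j → elem i ≡ elem j → i ≡ j
    elem-sound : ∀ i → P (elem i)

enumerate : ∀ {m} (p : Fin m → Bool) → Distinct (count p) (T ∘ p)
enumerate {zero} p = record { elem = λ () ; elem-injective = λ () ; elem-sound = λ () }
enumerate {suc m} p with p zero in p0
... | false = record
  { elem = suc ∘ elem
  ; elem-injective = λ i j → elem-injective i j ∘ suc-injective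
  ; elem-sound = elem-sound
  }
  where open Distinct (enumerate (p ∘ suc))
... | true = record { elem = elem′ ; elem-injective = elem′-injective ; elem-sound = elem′-sound }
  where
  open Distinct (enumerate (p ∘ suc))
  elem′ : Fin (suc (count (p ∘ suc))) → Fin (suc m)
  elem′ zero = zero
  elem′ (suc i) = suc (elem i)
  elem′-injective : ∀ i j → elem′ i ≡ elem′ j → i ≡ j
  elem′-injective zero zero _ = refl
  elem′-injective (suc i) (suc j) eq = cong suc (elem-injective i j (suc-injective eq))
  elem′-sound : ∀ i → T (p (elem′ i))
  elem′-sound zero = subst T (sym p0) tt
  elem′-sound (suc i) = elem-sound i

enumerate-exactly : ∀ {m k} (p : Fin m → Bool) → count p ≡ k → Distinct k (T ∘ p)
enumerate-exactly p refl = enumerate p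

1+a+b≡c+c∧c≤a⇒b<c : ∀ {a b c} → suc (a + b) ≡ c + c → c ≤ a → b < c
1+a+b≡c+c∧c≤a⇒b<c {a} {b} {c} eq c≤a = +-cancelˡ-≤ c (suc b) c (begin
  c + suc b   ≤⟨ +-monoˡ-≤ (suc b) c≤a ⟩
  a + suc b   ≡⟨ +-suc a b ⟩
  suc (a + b) ≡⟨ eq ⟩
  c + c       ∎)
  where open ≤-Reasoning

1+a+b≡c+c∧a<c⇒c≤b : ∀ {a b c} → suc (a + b) ≡ c + c → a < c → c ≤ b
1+a+b≡c+c∧a<c⇒c≤b {a} {b} {c} eq a<c = +-cancelˡ-≤ c c b (begin
  c + c       ≡⟨ eq ⟨
  suc a + b   ≤⟨ +-monoˡ-≤ b a<c ⟩
  c + b       ∎)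
  where open ≤-Reasoning

m+m≡n+n⇒m≡n : ∀ {m n} → m + m ≡ n + n → m ≡ n
m+m≡n+n⇒m≡n {m} {n} eq = *-cancelˡ-≡ m n 2 (begin
  2 * m        ≡⟨ cong (m +_) (+-identityʳ m) ⟩
  m + m        ≡⟨ eq ⟩
  n + n        ≡⟨ cong (n +_) (+-identityʳ n) ⟨
  2 * n        ∎)
  where open ≡-Reasoning

complement-≢ : ∀ {m} (G : Adj m) {x y} → x ≢ y → complement G x y ≡ not (G x y)
complement-≢ G {x} {y} x≢y = cong (λ b → not b ∧ not (G x y)) (⌊≟⌋-≢ x≢y)

degree-complement : ∀ {m} (G : Adj m) → (∀ x → G x x ≡ false) → ∀ x →
                    suc (degree G x + degree (complement G) x) ≡ m
degree-complement {m} G irreflexive x = begin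
  suc (degree G x + degree (complement G) x)
    ≡⟨ cong₂ _+_ (sym (count-≟ x))
                 (cong₂ _+_ (degree≡count G x) (degree≡count (complement G) x)) ⟩
  count (λ y → ⌊ x ≟ y ⌋) + (count (G x) + count (complement G x))
    ≡⟨ cong (count (λ y → ⌊ x ≟ y ⌋) +_) (∑-distrib-+ (indicator ∘ G x) (indicator ∘ complement G x)) ⟨
  count (λ y → ⌊ x ≟ y ⌋) + sum (λ y → indicator (G x y) + indicator (complement G x y))
    ≡⟨ ∑-distrib-+ (indicator ∘ (λ y → ⌊ x ≟ y ⌋)) _ ⟨
  sum (λ y → indicator ⌊ x ≟ y ⌋ + (indicator (G x y) + indicator (complement G x y)))
    ≡⟨ sum-cong-≗ partition ⟩
  count {m} (λ _ → true)
    ≡⟨ count-const-true m ⟩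
  m ∎
  where
  open ≡-Reasoning
  partition : ∀ y → indicator ⌊ x ≟ y ⌋ + (indicator (G x y) + indicator (complement G x y)) ≡ 1
  partition y with x ≟ y
  ... | yes refl rewrite irreflexive x = refl
  ... | no _ with G x y
  ...   | true = refl
  ...   | false = refl

degree-iso : ∀ {m} {G H : Adj m} → ((f , _) : Isomorphic G H) →
             ∀ x → degree G x ≡ degree H (Inverse.to f x)
degree-iso {G = G} {H} (f , f-iso) x = begin
  degree G x                      ≡⟨ degree≡count G x ⟩
  count (G x)                     ≡⟨ sum-cong-≗ (cong indicator ∘ f-iso x) ⟩
  count (H (to x) ∘ to)           ≡⟨ count-permute f (H (to x)) ⟩
  count (H (to x))                ≡⟨ degree≡count H (to x) ⟨
  degree H (to x)                 ∎
  where
  open ≡-Reasoning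
  open Inverse f using (to)

module SelfComplementaryGraph {m} (G : Adj m) (symmetric : ∀ x y → G x y ≡ G y x)
  (irreflexive : ∀ x → G x x ≡ false) (σ↔ : Fin m ↔ Fin m)
  (σ-iso : ∀ x y → G x y ≡ complement G (Inverse.to σ↔ x) (Inverse.to σ↔ y)) where

  open Inverse σ↔ using () renaming (to to σ; from to σ⁻¹; strictlyInverseˡ to σ∘σ⁻¹)

  σ-injective : ∀ {x y} → σ x ≡ σ y → x ≡ y
  σ-injective = Injection.injective (Inverse⇒Injection σ↔)

  degree+degree-σ : ∀ x → suc (degree G x + degree G (σ x)) ≡ m
  degree+degree-σ x = begin
    suc (degree G x + degree G (σ x))
      ≡⟨ cong (λ d → suc (d + degree G (σ x))) (degree-iso {H = complement G} (σ↔ , σ-iso) x) ⟩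
    suc (degree (complement G) (σ x) + degree G (σ x))
      ≡⟨ cong suc (+-comm _ (degree G (σ x))) ⟩
    suc (degree G (σ x) + degree (complement G) (σ x))
      ≡⟨ degree-complement G irreflexive (σ x) ⟩
    m ∎
    where open ≡-Reasoning

  adjacent-or-σ-adjacent : ∀ {x y} → x ≢ y → G x y ≡ true ⊎ G (σ x) (σ y) ≡ true
  adjacent-or-σ-adjacent {x} {y} x≢y with G x y in xy
  ... | true = inj₁ refl
  ... | false = inj₂ (not-injective (begin
    not (G (σ x) (σ y))        ≡⟨ complement-≢ G (x≢y ∘ σ-injective) ⟨
    complement G (σ x) (σ y)   ≡⟨ σ-iso x y ⟨
    G x y                      ≡⟨ xy ⟩
    false                      ∎))
    where open ≡-Reasoning

  module Threshold (c : ℕ) (m≡c+c : m ≡ c + c) where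

    High : Fin m → Set
    High x = c ≤ degree G x

    high? : Fin m → Bool
    high? x = ⌊ c ≤? degree G x ⌋

    high⇒σ-low : ∀ {x} → High x → degree G (σ x) < c
    high⇒σ-low {x} = 1+a+b≡c+c∧c≤a⇒b<c (trans (degree+degree-σ x) m≡c+c)

    low⇒σ-high : ∀ {x} → degree G x < c → High (σ x)
    low⇒σ-high {x} = 1+a+b≡c+c∧a<c⇒c≤b (trans (degree+degree-σ x) m≡c+c)

    σ-high⇒low : ∀ {x} → High (σ x) → degree G x < c
    σ-high⇒low {x} σx-high with c ≤? degree G x
    ... | yes x-high = ⊥-elim (<⇒≱ (high⇒σ-low x-high) σx-high)
    ... | no x-low = ≰⇒> x-low

    σ-fixed-point-free : ∀ x → x ≢ σ x
    σ-fixed-point-free x x≡σx with c ≤? degree G x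
    ... | yes x-high = <⇒≱ (high⇒σ-low x-high) (subst High x≡σx x-high)
    ... | no x-low = <⇒≱ (≰⇒> x-low) (subst High (sym x≡σx) (low⇒σ-high (≰⇒> x-low)))

    σ-edges-alternate : ∀ x → G x (σ x) ≡ not (G (σ x) (σ (σ x)))
    σ-edges-alternate x = trans (σ-iso x (σ x)) (complement-≢ G (σ-fixed-point-free (σ x)))

    count-high : count high? ≡ c
    count-high = m+m≡n+n⇒m≡n (begin
      count high? + count high?
        ≡⟨ cong (count high? +_) (count-permute σ↔ high?) ⟨
      count high? + count (high? ∘ σ)
        ≡⟨ ∑-distrib-+ (indicator ∘ high?) (indicator ∘ high? ∘ σ) ⟨
      sum (λ x → indicator (high? x) + indicator (high? (σ x)))
        ≡⟨ sum-cong-≗ exactly-one ⟩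
      count {m} (λ _ → true)
        ≡⟨ count-const-true m ⟩
      m
        ≡⟨ m≡c+c ⟩
      c + c ∎)
      where
      open ≡-Reasoning
      exactly-one : ∀ x → indicator (high? x) + indicator (high? (σ x)) ≡ 1
      exactly-one x with c ≤? degree G x | c ≤? degree G (σ x)
      ... | yes x-high | yes σx-high = ⊥-elim (<⇒≱ (high⇒σ-low x-high) σx-high)
      ... | yes _      | no _        = refl
      ... | no _       | yes _       = refl
      ... | no x-low   | no σx-low   = ⊥-elim (σx-low (low⇒σ-high (≰⇒> x-low)))

    enumerate-high : Distinct c High
    enumerate-high = record
      { elem = elem ; elem-injective = elem-injective ; elem-sound = toWitness ∘ elem-sound }
      where open Distinct (enumerate-exactly high? count-high)

    record SigmaEdge (h p : Fin m) : Set where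
      constructor σ-edge
      field
        base : Fin m
        base-adjacent : G base (σ base) ≡ true
        ends : (h ≡ base × p ≡ σ base) ⊎ (h ≡ σ base × p ≡ base)

    open SigmaEdge

    sigmaEdge-through : ∀ h → ∃[ p ] SigmaEdge h p
    sigmaEdge-through h with G h (σ h) in hσh
    ... | true = σ h , σ-edge h hσh (inj₁ (refl , refl))
    ... | false = σ⁻¹ h , σ-edge (σ⁻¹ h) σ⁻¹h-adjacent (inj₂ (sym (σ∘σ⁻¹ h) , refl))
      where
      σ⁻¹h-adjacent : G (σ⁻¹ h) (σ (σ⁻¹ h)) ≡ true
      σ⁻¹h-adjacent = trans (σ-edges-alternate (σ⁻¹ h))
                            (cong not (trans (cong (λ z → G z (σ z)) (σ∘σ⁻¹ h)) hσh))

    sigmaEdge-adjacent : ∀ {h p} → SigmaEdge h p → G h p ≡ true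
    sigmaEdge-adjacent (σ-edge _ adj (inj₁ (refl , refl))) = adj
    sigmaEdge-adjacent (σ-edge y adj (inj₂ (refl , refl))) = trans (symmetric (σ y) y) adj

    sigmaEdge-high⇒low : ∀ {h p} → High h → SigmaEdge h p → degree G p < c
    sigmaEdge-high⇒low h-high (σ-edge _ _ (inj₁ (refl , refl))) = high⇒σ-low h-high
    sigmaEdge-high⇒low h-high (σ-edge _ _ (inj₂ (refl , refl))) = σ-high⇒low h-high

    no-consecutive-σ-edges : ∀ {y} → G y (σ y) ≡ true → G (σ y) (σ (σ y)) ≢ true
    no-consecutive-σ-edges {y} adj adj′
      with () ← trans (sym adj) (trans (σ-edges-alternate y) (cong not adj′))

    sigmaEdge-injectiveˡ : ∀ {h h′ p} → SigmaEdge h p → SigmaEdge h′ p → h ≡ h′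
    sigmaEdge-injectiveˡ (σ-edge _ _ (inj₁ (refl , refl))) (σ-edge _ _ (inj₁ (refl , σy≡σy′))) =
      σ-injective σy≡σy′
    sigmaEdge-injectiveˡ (σ-edge _ _ (inj₂ (refl , refl))) (σ-edge _ _ (inj₂ (refl , refl))) = refl
    sigmaEdge-injectiveˡ (σ-edge _ adj (inj₁ (refl , refl))) (σ-edge _ adj′ (inj₂ (refl , refl))) =
      ⊥-elim (no-consecutive-σ-edges adj adj′)
    sigmaEdge-injectiveˡ (σ-edge _ adj (inj₂ (refl , refl))) (σ-edge _ adj′ (inj₁ (refl , refl))) =
      ⊥-elim (no-consecutive-σ-edges adj′ adj)

    sigmaEdge-base-injective : ∀ {h h′ p p′} → High h → High h′ →
      (e : SigmaEdge h p) (e′ : SigmaEdge h′ p′) → base e ≡ base e′ → h ≡ h′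
    sigmaEdge-base-injective _ _ (σ-edge _ _ (inj₁ (refl , _))) (σ-edge _ _ (inj₁ (refl , _))) refl = refl
    sigmaEdge-base-injective _ _ (σ-edge _ _ (inj₂ (refl , _))) (σ-edge _ _ (inj₂ (refl , _))) refl = refl
    sigmaEdge-base-injective h-high h′-high (σ-edge _ _ (inj₁ (refl , _))) (σ-edge _ _ (inj₂ (refl , _))) refl =
      ⊥-elim (<⇒≱ (high⇒σ-low h-high) h′-high)
    sigmaEdge-base-injective h-high h′-high (σ-edge _ _ (inj₂ (refl , _))) (σ-edge _ _ (inj₁ (refl , _))) refl =
      ⊥-elim (<⇒≱ (high⇒σ-low h′-high) h-high)

    base-∈ : ∀ {h p} (e : SigmaEdge h p) → base e ≡ h ⊎ base e ≡ p
    base-∈ (σ-edge _ _ (inj₁ (refl , _))) = inj₁ refl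
    base-∈ (σ-edge _ _ (inj₂ (_ , refl))) = inj₂ refl

    σ-base-∈ : ∀ {h p} (e : SigmaEdge h p) → σ (base e) ≡ h ⊎ σ (base e) ≡ p
    σ-base-∈ (σ-edge _ _ (inj₁ (_ , refl))) = inj₂ refl
    σ-base-∈ (σ-edge _ _ (inj₂ (refl , _))) = inj₁ refl

    sigmaEdges-linked : ∀ {h h′ p p′} (e : SigmaEdge h p) (e′ : SigmaEdge h′ p′) →
      base e ≢ base e′ → ∃[ u ] ∃[ v ] ((u ≡ h ⊎ u ≡ p) × (v ≡ h′ ⊎ v ≡ p′) × (G u v ≡ true))
    sigmaEdges-linked e e′ base≢base′ with adjacent-or-σ-adjacent base≢base′
    ... | inj₁ adj = base e , base e′ , base-∈ e , base-∈ e′ , adj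
    ... | inj₂ adj = σ (base e) , σ (base e′) , σ-base-∈ e , σ-base-∈ e′ , adj

lemma7 : (n : ℕ) → n ≥ 1 → (G : Adj (4 * n)) → IsSimpleGraph G → SelfComplementary G →
    ∃[ a ] ∃[ b ] (IsMatching {4 * n} {2 * n} a b × (∀ i → InL n G (a i) (b i))
    × IsComplete (ContractedAdj G a b))
lemma7 n _ G (symmetric , irreflexive) (σ↔ , σ-iso) =
  a , b , (a-injective , b-injective , a≢b) , a—b∈L , complete
  where
  open SelfComplementaryGraph G symmetric irreflexive σ↔ σ-iso
  open Threshold (2 * n) (*-distribʳ-+ n 2 2)
  open Distinct enumerate-high renaming (elem to a; elem-injective to a-injective; elem-sound to a-high)

  b : Fin (2 * n) → Fin (4 * n)
  b i = proj₁ (sigmaEdge-through (a i))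
  edge : ∀ i → SigmaEdge (a i) (b i)
  edge i = proj₂ (sigmaEdge-through (a i))

  b-injective : ∀ i j → b i ≡ b j → i ≡ j
  b-injective i j bi≡bj =
    a-injective i j (sigmaEdge-injectiveˡ (edge i) (subst (SigmaEdge (a j)) (sym bi≡bj) (edge j)))
  a≢b : ∀ i j → a i ≢ b j
  a≢b i j ai≡bj = <⇒≱ (sigmaEdge-high⇒low (a-high j) (edge j)) (subst High ai≡bj (a-high i))
  a—b∈L : ∀ i → InL n G (a i) (b i)
  a—b∈L i = sigmaEdge-adjacent (edge i) , a-high i , sigmaEdge-high⇒low (a-high i) (edge i)
  complete : IsComplete (ContractedAdj G a b)
  complete i j i≢j = i≢j , sigmaEdges-linked (edge i) (edge j)
    (i≢j ∘ a-injective i j ∘ sigmaEdge-base-injective (a-high i) (a-high j) (edge i) (edge j))
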